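{- Let $G$ be a (simple) graph with $n$ vertices and $m$ edges, where $m\neq 1$. Then $$\frac{\sqrt{4(m-1)(n^2+n)+(m+2n+1)^2}-(m+2n+1)}{2(m-1)}\le\alpha(G).$$
   Context: The independence number $\alpha(G)$ of a graph $G$ is the largest cardinality of a set of vertices no two of which are adjacent. -}

module Defs where

open import Data.Nat as ℕ using (ℕ; suc)
open import Data.Integer as ℤ using (ℤ; +_; _+_; _*_; _-_; _≤_; _<_; +<+; +≤+)
open import Data.Fin using (Fin; toℕ)
open import Data.Fin.Subset using (Subset; _∈_; ∣_∣)
open import Data.Bool using (Bool; true; false; if_then_else_; _∧_)
open import Data.List using (map; allFin)
open import Data.Nat.ListAction using (sum)
open import Data.Sum using (_⊎_)
open import Data.Product using (_×_; Σ-syntax)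
open import Relation.Binary.PropositionalEquality using (_≡_)
open import Relation.Nullary.Decidable using (⌊_⌋)

record Graph (n : ℕ) : Set where
  field
    adj     : Fin n → Fin n → Bool
    sym     : ∀ i j → adj i j ≡ adj j i
    irrefl  : ∀ i → adj i i ≡ false
open Graph public

edgeCount : ∀ {n} → Graph n → ℕ
edgeCount {n} G =
  sum (map (λ i → sum (map (λ j →
         if ⌊ toℕ i ℕ.<? toℕ j ⌋ ∧ adj G i j then 1 else 0) (allFin n))) (allFin n))

Independent : ∀ {n} → Graph n → Subset n → Set
Independent G s = ∀ i j → i ∈ s → j ∈ s → adj G i j ≡ false

IsIndependenceNumber : ∀ {n} → Graph n → ℕ → Set
IsIndependenceNumber {n} G k =
  (Σ[ s ∈ Subset n ] (Independent G s × ∣ s ∣ ≡ k)) ×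
  (∀ (s : Subset n) → Independent G s → ∣ s ∣ ℕ.≤ k)

-- Exact (real-free) encoding of the real inequality
--     (√D − B) / (2A) ≤ x        (D, B, A, x integers, A ≠ 0; the real
-- inequality is meaningful only when D ≥ 0, which is required explicitly).
-- For A > 0 it is  √D ≤ 2Ax + B,  i.e.  0 ≤ 2Ax + B  and  D ≤ (2Ax + B)².
-- For A < 0 it is  √D ≥ 2Ax + B,  i.e.  2Ax + B < 0  or  (2Ax + B)² ≤ D.
-- (A = 0 is not given a meaning; the value is ⊥-free but irrelevant.)
SqrtQuotientLe : (D B A x : ℤ) → Set
SqrtQuotientLe D B A x with A
... | ℤ.pos (suc _) = (+ 0 ≤ D) × (+ 0 ≤ t) × (D ≤ t * t)
  where t = + 2 * A * x + B
... | ℤ.negsuc _    = (+ 0 ≤ D) × ((t < + 0) ⊎ (t * t ≤ D))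
  where t = + 2 * A * x + B
... | ℤ.pos 0       = Data.Empty.⊥
  where import Data.Empty

{-# OPTIONS --safe #-}
-- The bound is the positive root of q(x) = (m - 1)x² + (m + 2n + 1)x - (n² + n), and the quantity
-- under the square root is its discriminant D, with (2(m - 1)x + m + 2n + 1)² - D = 4(m - 1)q(x).
-- Writing n = α + r, one has q(α) = m·α(α + 1) - r(r + 1); so for m ≥ 2 it suffices that
-- r(r + 1) ≤ m·α(α + 1), and for m = 0 the same inequality forces α = n. A greedily built maximal independent set S
-- dominates the graph, hence n ≤ Σ_{s ∈ S} (deg s + 1) ≤ α(d + 1) for a vertex s ∈ S of
-- maximal degree d, which gives r + 1 ≤ αd. Deleting s removes d edges and does not increase
-- α, while r(r + 1) grows by 2(r + 1) ≤ 2αd ≤ d·α(α + 1) from r to r + 1.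
module Submission where

open import Defs hiding (sym)
open import Data.Bool using (Bool; false; if_then_else_; _∧_)
open import Data.Fin using (Fin; zero; suc; toℕ)
open import Data.Fin.Subset using (Subset; inside; outside; ∣_∣) renaming (_∈_ to _∈ₛ_)
open import Data.Fin.Subset.Properties using (∣p∣≤n)
open import Data.List using (List; []; _∷_; _++_; length; map; tabulate; allFin)
open import Data.List.Properties using (map-tabulate; map-cong; length-++-sucʳ; length-tabulate)
open import Data.List.Membership.Propositional using (_∈_)
open import Data.List.Membership.Propositional.Properties using (∈-∃++)
open import Data.List.Relation.Unary.All using (All; []; _∷_)
open import Data.List.Relation.Unary.Any using (here; there)
open import Data.List.Relation.Binary.Sublist.Propositional using (_⊆_; []; _∷_; _∷ʳ_; ⊆-refl; ⊆-trans; lookup)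
open import Data.List.Relation.Binary.Sublist.Propositional.Properties using (++⁺)
open import Data.Nat using (ℕ; zero; suc; z≤n; s≤s)
open import Data.Nat.ListAction using (sum)
open import Data.Product using (Σ-syntax; _×_; _,_)
open import Data.Sum using (inj₂; [_,_]′)
open import Data.Vec using ([]; _∷_; here; there)
open import Function using (_∘_; id)
open import Relation.Nullary using (contradiction)
open import Relation.Nullary.Decidable using (⌊_⌋; isYes≗does)
open import Relation.Binary.PropositionalEquality
  using (_≡_; _≢_; refl; sym; trans; cong; cong₂; subst; subst₂; module ≡-Reasoning)

module _ {A : Set} where

  indices : ∀ {n} (f : Fin n → A) {xs} → xs ⊆ tabulate f → Subset n
  indices {zero}  f []         = []
  indices {suc n} f (_ ∷ʳ xs⊆) = outside ∷ indices (f ∘ suc) xs⊆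
  indices {suc n} f (_ ∷ xs⊆)  = inside ∷ indices (f ∘ suc) xs⊆

  ∣indices∣ : ∀ {n} (f : Fin n → A) {xs} (xs⊆ : xs ⊆ tabulate f) → ∣ indices f xs⊆ ∣ ≡ length xs
  ∣indices∣ {zero}  f []           = refl
  ∣indices∣ {suc n} f (_ ∷ʳ xs⊆)   = ∣indices∣ (f ∘ suc) xs⊆
  ∣indices∣ {suc n} f (refl ∷ xs⊆) = cong suc (∣indices∣ (f ∘ suc) xs⊆)

  ∈-indices : ∀ {n} (f : Fin n → A) {xs} (xs⊆ : xs ⊆ tabulate f) {i} → i ∈ₛ indices f xs⊆ → f i ∈ xs
  ∈-indices {suc n} f (_ ∷ʳ xs⊆)   (there i∈) = ∈-indices (f ∘ suc) xs⊆ i∈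
  ∈-indices {suc n} f (refl ∷ xs⊆) here       = here refl
  ∈-indices {suc n} f (refl ∷ xs⊆) (there i∈) = there (∈-indices (f ∘ suc) xs⊆ i∈)

module Combinatorial where

  open import Data.Nat using (_+_; _*_; _≤_; _<_; _<?_; s≤s⁻¹)
  open import Data.Nat.Properties
  open import Data.Nat.Tactic.RingSolver using (solve-∀)
  open import Data.List.Extrema.Nat using (argmax; argmax-sel; f[⊥]≤f[argmax]; f[xs]≤f[argmax])
  open import Algebra.Properties.CommutativeSemigroup +-commutativeSemigroup using (interchange; x∙yz≈y∙xz)
  open ≤-Reasoning

  𝟙 : Bool → ℕ
  𝟙 b = if b then 1 else 0

  𝟙≡0 : ∀ {b} → 𝟙 b ≡ 0 → b ≡ false
  𝟙≡0 {false} _ = refl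

  -- Both sides compute to m <ᵇ n.
  <?-suc : ∀ m n → ⌊ suc m <? suc n ⌋ ≡ ⌊ m <? n ⌋
  <?-suc m n = trans (isYes≗does (suc m <? suc n)) (sym (isYes≗does (m <? n)))

  sum-allFin-suc : ∀ {n} (g : Fin (suc n) → ℕ) →
                   sum (map g (allFin (suc n))) ≡ g zero + sum (map (g ∘ suc) (allFin n))
  sum-allFin-suc g = cong (λ gs → g zero + sum gs) (trans (map-tabulate suc g) (sym (map-tabulate id (g ∘ suc))))

  sum≤length*bound : ∀ {A : Set} {f : A → ℕ} {b} xs → All (λ x → f x ≤ b) xs → sum (map f xs) ≤ length xs * b
  sum≤length*bound []       []             = z≤n
  sum≤length*bound (x ∷ xs) (fx≤b ∷ fxs≤b) = +-mono-≤ fx≤b (sum≤length*bound xs fxs≤b)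

  sum≤length*argmax : ∀ {A : Set} (f : A → ℕ) x xs → sum (map f (x ∷ xs)) ≤ length (x ∷ xs) * f (argmax f x xs)
  sum≤length*argmax f x xs = sum≤length*bound (x ∷ xs) (f[⊥]≤f[argmax] {f = f} x xs ∷ f[xs]≤f[argmax] {f = f} x xs)

  argmax∈ : ∀ {A : Set} (f : A → ℕ) x xs → argmax f x xs ∈ x ∷ xs
  argmax∈ f x xs = [ here , there ]′ (argmax-sel f x xs)

  pronic : ℕ → ℕ
  pronic x = x * suc x

  pronic-suc : ∀ x → suc x * suc (suc x) ≡ 2 * suc x + x * suc x
  pronic-suc = solve-∀

  covering⇒2[1+r]≤d*pronic : ∀ r k d → suc r + k ≤ k * suc d → 2 * suc r ≤ d * pronic k
  covering⇒2[1+r]≤d*pronic r zero      d ()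
  covering⇒2[1+r]≤d*pronic r k@(suc _) d cover = begin
      2 * suc r        ≤⟨ *-monoʳ-≤ 2 1+r≤kd ⟩
      2 * (k * d)      ≤⟨ *-monoˡ-≤ (k * d) {2} {suc k} (s≤s (s≤s z≤n)) ⟩
      suc k * (k * d)  ≡⟨ reorder k d ⟩
      d * pronic k     ∎
    where
    1+r≤kd : suc r ≤ k * d
    1+r≤kd = +-cancelʳ-≤ k (suc r) (k * d) (≤-trans cover (≤-reflexive (trans (*-suc k d) (+-comm k (k * d)))))
    reorder : ∀ k d → suc k * (k * d) ≡ d * (k * suc k)
    reorder = solve-∀

  module ListGraph {V : Set} (adj : V → V → Bool)
                   (adj-sym : ∀ x y → adj x y ≡ adj y x)
                   (adj-irrefl : ∀ x → adj x x ≡ false) where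

    degree : V → List V → ℕ
    degree x []       = 0
    degree x (y ∷ ys) = 𝟙 (adj x y) + degree x ys

    closedDegree : List V → V → ℕ
    closedDegree xs x = suc (degree x xs)

    edges : List V → ℕ
    edges []       = 0
    edges (x ∷ xs) = degree x xs + edges xs

    degree-insert : ∀ x xs y ys → degree x (xs ++ y ∷ ys) ≡ 𝟙 (adj x y) + degree x (xs ++ ys)
    degree-insert x []       y ys = refl
    degree-insert x (z ∷ xs) y ys =
      trans (cong (𝟙 (adj x z) +_) (degree-insert x xs y ys)) (x∙yz≈y∙xz (𝟙 (adj x z)) (𝟙 (adj x y)) (degree x (xs ++ ys)))

    edges-insert : ∀ xs y ys → edges (xs ++ y ∷ ys) ≡ degree y (xs ++ ys) + edges (xs ++ ys)
    edges-insert []       y ys = refl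
    edges-insert (x ∷ xs) y ys = begin-equality
      degree x (xs ++ y ∷ ys) + edges (xs ++ y ∷ ys)
        ≡⟨ cong₂ _+_ (degree-insert x xs y ys) (edges-insert xs y ys) ⟩
      (𝟙 (adj x y) + degree x (xs ++ ys)) + (degree y (xs ++ ys) + edges (xs ++ ys))
        ≡⟨ interchange (𝟙 (adj x y)) (degree x (xs ++ ys)) (degree y (xs ++ ys)) (edges (xs ++ ys)) ⟩
      (𝟙 (adj x y) + degree y (xs ++ ys)) + (degree x (xs ++ ys) + edges (xs ++ ys))
        ≡⟨ cong (λ b → 𝟙 b + degree y (xs ++ ys) + (degree x (xs ++ ys) + edges (xs ++ ys))) (adj-sym x y) ⟩
      (𝟙 (adj y x) + degree y (xs ++ ys)) + (degree x (xs ++ ys) + edges (xs ++ ys)) ∎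

    edges-remove : ∀ xs y ys → edges (xs ++ y ∷ ys) ≡ degree y (xs ++ y ∷ ys) + edges (xs ++ ys)
    edges-remove xs y ys = trans (edges-insert xs y ys) (cong (_+ edges (xs ++ ys)) (sym degree-self))
      where
      degree-self : degree y (xs ++ y ∷ ys) ≡ degree y (xs ++ ys)
      degree-self = trans (degree-insert y xs y ys) (cong (λ b → 𝟙 b + degree y (xs ++ ys)) (adj-irrefl y))

    closedDegrees-∷ : ∀ S x xs → sum (map (closedDegree (x ∷ xs)) S) ≡ degree x S + sum (map (closedDegree xs) S)
    closedDegrees-∷ []      x xs = refl
    closedDegrees-∷ (s ∷ S) x xs = begin-equality
      suc (𝟙 (adj s x) + degree s xs) + sum (map (closedDegree (x ∷ xs)) S)
        ≡⟨ cong₂ _+_ (cong (λ b → suc (𝟙 b + degree s xs)) (adj-sym s x)) (closedDegrees-∷ S x xs) ⟩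
      suc (𝟙 (adj x s) + degree s xs) + (degree x S + rest)
        ≡⟨ cong (_+ (degree x S + rest)) (sym (+-suc (𝟙 (adj x s)) (degree s xs))) ⟩
      (𝟙 (adj x s) + suc (degree s xs)) + (degree x S + rest)
        ≡⟨ interchange (𝟙 (adj x s)) (suc (degree s xs)) (degree x S) rest ⟩
      (𝟙 (adj x s) + degree x S) + (suc (degree s xs) + rest) ∎
      where rest = sum (map (closedDegree xs) S)

    IndependentList : List V → Set
    IndependentList S = ∀ {x y} → x ∈ S → y ∈ S → adj x y ≡ false

    IndependenceAtMost : ℕ → List V → Set
    IndependenceAtMost k xs = ∀ {S} → S ⊆ xs → IndependentList S → length S ≤ k

    IndependenceAtMost-⊆ : ∀ {k xs ys} → ys ⊆ xs → IndependenceAtMost k xs → IndependenceAtMost k ys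
    IndependenceAtMost-⊆ ys⊆xs α≤k S⊆ys = α≤k (⊆-trans S⊆ys ys⊆xs)

    degree≡0⇒¬adj : ∀ {x y} S → degree x S ≡ 0 → y ∈ S → adj x y ≡ false
    degree≡0⇒¬adj {x} (z ∷ S) deg≡0 (here refl) = 𝟙≡0 (m+n≡0⇒m≡0 (𝟙 (adj x z)) deg≡0)
    degree≡0⇒¬adj {x} (z ∷ S) deg≡0 (there y∈S) = degree≡0⇒¬adj S (m+n≡0⇒n≡0 (𝟙 (adj x z)) deg≡0) y∈S

    ∷-independent : ∀ {x S} → (∀ {y} → y ∈ S → adj x y ≡ false) → IndependentList S → IndependentList (x ∷ S)
    ∷-independent x≁S indS (here refl) (here refl) = adj-irrefl _
    ∷-independent x≁S indS (here refl) (there y∈S) = x≁S y∈S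
    ∷-independent x≁S indS (there x∈S) (here refl) = trans (adj-sym _ _) (x≁S x∈S)
    ∷-independent x≁S indS (there x∈S) (there y∈S) = indS x∈S y∈S

    greedy : List V → List V
    greedy []       = []
    greedy (x ∷ xs) with degree x (greedy xs)
    ... | zero  = x ∷ greedy xs
    ... | suc _ = greedy xs

    greedy-⊆ : ∀ xs → greedy xs ⊆ xs
    greedy-⊆ []       = []
    greedy-⊆ (x ∷ xs) with degree x (greedy xs)
    ... | zero  = refl ∷ greedy-⊆ xs
    ... | suc _ = x ∷ʳ greedy-⊆ xs

    greedy-independent : ∀ xs → IndependentList (greedy xs)
    greedy-independent (x ∷ xs) with degree x (greedy xs) in deg≡0
    ... | zero  = ∷-independent (degree≡0⇒¬adj (greedy xs) deg≡0) (greedy-independent xs)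
    ... | suc _ = greedy-independent xs

    greedy-dominates : ∀ xs → length xs ≤ sum (map (closedDegree xs) (greedy xs))
    greedy-dominates []       = z≤n
    greedy-dominates (x ∷ xs) with degree x (greedy xs) in deg
    ... | zero  = s≤s (begin
      length xs                                        ≤⟨ greedy-dominates xs ⟩
      sum (map (closedDegree xs) (greedy xs))          ≤⟨ m≤n+m _ _ ⟩
      degree x (greedy xs) + sum (map (closedDegree xs) (greedy xs))
                                                       ≡⟨ closedDegrees-∷ (greedy xs) x xs ⟨
      sum (map (closedDegree (x ∷ xs)) (greedy xs))    ≤⟨ m≤n+m _ _ ⟩
      degree x (x ∷ xs) + sum (map (closedDegree (x ∷ xs)) (greedy xs)) ∎)
    ... | suc _ = begin
      suc (length xs)                                  ≤⟨ s≤s (greedy-dominates xs) ⟩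
      1 + sum (map (closedDegree xs) (greedy xs))      ≤⟨ +-monoˡ-≤ _ (subst (1 ≤_) (sym deg) (s≤s z≤n)) ⟩
      degree x (greedy xs) + sum (map (closedDegree xs) (greedy xs))
                                                       ≡⟨ closedDegrees-∷ (greedy xs) x xs ⟨
      sum (map (closedDegree (x ∷ xs)) (greedy xs))    ∎

    high-degree-vertex : ∀ {k} xs → IndependenceAtMost k xs → 0 < length xs →
                         Σ[ s ∈ V ] s ∈ xs × length xs ≤ k * closedDegree xs s
    high-degree-vertex {k} xs α≤k 0<n
      with greedy xs | greedy-⊆ xs | greedy-independent xs | greedy-dominates xs
    ... | []    | _    | _    | n≤0 = contradiction (≤-trans 0<n n≤0) λ ()
    ... | s ∷ S | G⊆xs | indG | n≤Σ = argmax f s S , lookup G⊆xs (argmax∈ f s S) , (begin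
      length xs                          ≤⟨ n≤Σ ⟩
      sum (map f (s ∷ S))                ≤⟨ sum≤length*argmax f s S ⟩
      length (s ∷ S) * f (argmax f s S)  ≤⟨ *-monoˡ-≤ _ (α≤k G⊆xs indG) ⟩
      k * f (argmax f s S)               ∎)
      where f = closedDegree xs

    pronic-bound : ∀ {k} r xs → IndependenceAtMost k xs → r + k ≤ length xs → pronic r ≤ edges xs * pronic k
    pronic-bound zero _ _ _ = z≤n
    pronic-bound {k} (suc r) xs α≤k r+k≤n
      with s , s∈xs , cover ← high-degree-vertex xs α≤k (≤-trans (s≤s z≤n) r+k≤n)
      with ys , zs , refl ← ∈-∃++ s∈xs
      = begin
        pronic (suc r)                            ≡⟨ pronic-suc r ⟩
        2 * suc r + pronic r                      ≤⟨ +-mono-≤ (covering⇒2[1+r]≤d*pronic r k d (≤-trans r+k≤n cover)) ih ⟩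
        d * pronic k + edges (ys ++ zs) * pronic k ≡⟨ *-distribʳ-+ (pronic k) d _ ⟨
        (d + edges (ys ++ zs)) * pronic k         ≡⟨ cong (_* pronic k) (edges-remove ys s zs) ⟨
        edges (ys ++ s ∷ zs) * pronic k           ∎
      where
      d = degree s (ys ++ s ∷ zs)
      ih : pronic r ≤ edges (ys ++ zs) * pronic k
      ih = pronic-bound r (ys ++ zs) (IndependenceAtMost-⊆ (++⁺ ⊆-refl (s ∷ʳ ⊆-refl)) α≤k)
             (s≤s⁻¹ (subst (suc r + k ≤_) (length-++-sucʳ ys s zs) r+k≤n))

    laterAdjacent : ∀ {n} → (Fin n → V) → Fin n → Fin n → ℕ
    laterAdjacent f i j = 𝟙 (⌊ toℕ i <? toℕ j ⌋ ∧ adj (f i) (f j))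

    upperDegree : ∀ {n} → (Fin n → V) → Fin n → ℕ
    upperDegree {n} f i = sum (map (laterAdjacent f i) (allFin n))

    degree-tabulate : ∀ {n} x (f : Fin n → V) → degree x (tabulate f) ≡ sum (map (λ j → 𝟙 (adj x (f j))) (allFin n))
    degree-tabulate {zero}  x f = refl
    degree-tabulate {suc n} x f =
      trans (cong (𝟙 (adj x (f zero)) +_) (degree-tabulate x (f ∘ suc))) (sym (sum-allFin-suc (λ j → 𝟙 (adj x (f j)))))

    upperDegree-zero : ∀ {n} (f : Fin (suc n) → V) → upperDegree f zero ≡ degree (f zero) (tabulate (f ∘ suc))
    upperDegree-zero f = trans (sum-allFin-suc (laterAdjacent f zero)) (sym (degree-tabulate (f zero) (f ∘ suc)))

    upperDegree-suc : ∀ {n} (f : Fin (suc n) → V) i → upperDegree f (suc i) ≡ upperDegree (f ∘ suc) i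
    upperDegree-suc f i = trans (sum-allFin-suc (laterAdjacent f (suc i))) (cong sum (map-cong later-neighbour (allFin _)))
      where
      later-neighbour : ∀ j → laterAdjacent f (suc i) (suc j) ≡ laterAdjacent (f ∘ suc) i j
      later-neighbour j = cong (λ b → 𝟙 (b ∧ adj (f (suc i)) (f (suc j)))) (<?-suc (toℕ i) (toℕ j))

    edges-tabulate : ∀ {n} (f : Fin n → V) → edges (tabulate f) ≡ sum (map (upperDegree f) (allFin n))
    edges-tabulate {zero}  f = refl
    edges-tabulate {suc n} f = begin-equality
      degree (f zero) (tabulate (f ∘ suc)) + edges (tabulate (f ∘ suc))
        ≡⟨ cong₂ _+_ (sym (upperDegree-zero f)) (edges-tabulate (f ∘ suc)) ⟩
      upperDegree f zero + sum (map (upperDegree (f ∘ suc)) (allFin n))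
        ≡⟨ cong (λ u → upperDegree f zero + sum u) (map-cong (upperDegree-suc f) (allFin n)) ⟨
      upperDegree f zero + sum (map (upperDegree f ∘ suc) (allFin n))
        ≡⟨ sum-allFin-suc (upperDegree f) ⟨
      sum (map (upperDegree f) (allFin (suc n))) ∎

  module _ {n} (G : Graph n) where

    open ListGraph (adj G) (Graph.sym G) (irrefl G)

    edgeCount≡edges : edgeCount G ≡ edges (allFin n)
    edgeCount≡edges = sym (edges-tabulate id)

    IsIndependenceNumber⇒IndependenceAtMost : ∀ {k} → IsIndependenceNumber G k → IndependenceAtMost k (allFin n)
    IsIndependenceNumber⇒IndependenceAtMost {k} (_ , maximal) {S} S⊆ indS =
      subst (_≤ k) (∣indices∣ id S⊆) (maximal (indices id S⊆) λ i j i∈ j∈ → indS (∈-indices id S⊆ i∈) (∈-indices id S⊆ j∈))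

    independenceNumber≤order : ∀ {k} → IsIndependenceNumber G k → k ≤ n
    independenceNumber≤order ((s , _ , ∣s∣≡k) , _) = subst (_≤ n) ∣s∣≡k (∣p∣≤n s)

  independenceNumber-pronic-bound : ∀ {k r} (G : Graph (k + r)) → IsIndependenceNumber G k → pronic r ≤ edgeCount G * pronic k
  independenceNumber-pronic-bound {k} {r} G α≡k =
    subst (λ m → pronic r ≤ m * pronic k) (sym (edgeCount≡edges G))
      (pronic-bound r (allFin (k + r)) (IsIndependenceNumber⇒IndependenceAtMost G α≡k) r+k≤n)
    where
    open ListGraph (adj G) (Graph.sym G) (irrefl G)
    r+k≤n : r + k ≤ length (allFin (k + r))
    r+k≤n = ≤-reflexive (trans (+-comm r k) (sym (length-tabulate id)))

  coefficientℕ : ℕ → ℕ → ℕ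
  coefficientℕ a n = suc a + 2 * n + 1

  discriminantℕ : ℕ → ℕ → ℕ
  discriminantℕ a n = 4 * a * (n * n + n) + coefficientℕ a n * coefficientℕ a n

  -- (2ak + b)² - D = 4a·q(k), where q(k) = (1 + a)·k(k + 1) - r(r + 1) for n = k + r.
  discriminant-identity : ∀ a k r →
    4 * a * ((k + r) * (k + r) + (k + r)) + (suc a + 2 * (k + r) + 1) * (suc a + 2 * (k + r) + 1)
      + 4 * a * (suc a * (k * suc k))
    ≡ (2 * a * k + (suc a + 2 * (k + r) + 1)) * (2 * a * k + (suc a + 2 * (k + r) + 1)) + 4 * a * (r * suc r)
  discriminant-identity = solve-∀

  discriminant≤square : ∀ a k r → pronic r ≤ suc a * pronic k →
    discriminantℕ a (k + r) ≤ (2 * a * k + coefficientℕ a (k + r)) * (2 * a * k + coefficientℕ a (k + r))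
  discriminant≤square a k r q≥0 = +-cancelʳ-≤ (4 * a * pronic r) _ _ (begin
    discriminantℕ a (k + r) + 4 * a * pronic r
      ≤⟨ +-monoʳ-≤ (discriminantℕ a (k + r)) (*-monoʳ-≤ (4 * a) q≥0) ⟩
    discriminantℕ a (k + r) + 4 * a * (suc a * pronic k)
      ≡⟨ discriminant-identity a k r ⟩
    (2 * a * k + coefficientℕ a (k + r)) * (2 * a * k + coefficientℕ a (k + r)) + 4 * a * pronic r ∎)

open Combinatorial
  using (pronic; coefficientℕ; discriminantℕ; discriminant≤square; independenceNumber≤order; independenceNumber-pronic-bound)

import Data.Nat as ℕ
open import Data.Nat.Properties using (+-identityʳ; m≤n⇒∃[o]m+o≡n)
open import Data.Integer using (ℤ; +_; _+_; _*_; _-_; _≤_; +≤+)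
open import Data.Integer.Properties using (pos-*; ≤-refl)
open import Data.Integer.Tactic.RingSolver using (solve-∀)

coefficient : ℕ → ℕ → ℤ
coefficient m n = + m + + 2 * + n + + 1

discriminant : ℕ → ℕ → ℤ
discriminant m n = + 4 * (+ m - + 1) * (+ n * + n + + n) + coefficient m n * coefficient m n

coefficient-cast : ∀ a n → coefficient (suc a) n ≡ + coefficientℕ a n
coefficient-cast a n = cong (λ t → + suc a + t + + 1) (sym (pos-* 2 n))

discriminant-cast : ∀ a n → discriminant (suc a) n ≡ + discriminantℕ a n
discriminant-cast a n = cong₂ _+_ quadratic-term (trans (cong₂ _*_ b≡ b≡) (sym (pos-* (coefficientℕ a n) _)))
  where
  open ≡-Reasoning
  b≡ = coefficient-cast a n
  quadratic-term : + 4 * + a * (+ n * + n + + n) ≡ + (4 ℕ.* a ℕ.* (n ℕ.* n ℕ.+ n))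
  quadratic-term = begin
    + 4 * + a * (+ n * + n + + n)     ≡⟨ cong₂ (λ x y → x * (y + + n)) (sym (pos-* 4 a)) (sym (pos-* n n)) ⟩
    + (4 ℕ.* a) * + (n ℕ.* n ℕ.+ n)   ≡⟨ pos-* (4 ℕ.* a) (n ℕ.* n ℕ.+ n) ⟨
    + (4 ℕ.* a ℕ.* (n ℕ.* n ℕ.+ n))   ∎

sqrtQuotientLe⁺ : ∀ {D B} a x {d b} → D ≡ + d → B ≡ + b →
  d ℕ.≤ (2 ℕ.* suc a ℕ.* x ℕ.+ b) ℕ.* (2 ℕ.* suc a ℕ.* x ℕ.+ b) → SqrtQuotientLe D B (+ suc a) (+ x)
sqrtQuotientLe⁺ a x {d} {b} refl refl d≤t² =
  +≤+ z≤n , subst (+ 0 ≤_) (sym t≡) (+≤+ z≤n) , subst (+ d ≤_) (trans (pos-* t t) (cong₂ _*_ (sym t≡) (sym t≡))) (+≤+ d≤t²)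
  where
  t = 2 ℕ.* suc a ℕ.* x ℕ.+ b
  t≡ : + 2 * + suc a * + x + + b ≡ + t
  t≡ = cong (_+ + b) (sym (pos-* (2 ℕ.* suc a) x))

edgeless-discriminant : ∀ N → + 4 * (+ 0 - + 1) * (N * N + N) + (+ 0 + + 2 * N + + 1) * (+ 0 + + 2 * N + + 1) ≡ + 1
edgeless-discriminant = solve-∀

edgeless-2Ax+B : ∀ N → + 2 * (+ 0 - + 1) * N + (+ 0 + + 2 * N + + 1) ≡ + 1
edgeless-2Ax+B = solve-∀

edgeless-bound : ∀ n → SqrtQuotientLe (discriminant 0 n) (coefficient 0 n) (+ 0 - + 1) (+ n)
edgeless-bound n = subst (+ 0 ≤_) (sym D≡1) (+≤+ z≤n) , inj₂ (subst₂ _≤_ (sym (cong₂ _*_ t≡1 t≡1)) (sym D≡1) ≤-refl)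
  where
  D≡1 = edgeless-discriminant (+ n)
  t≡1 = edgeless-2Ax+B (+ n)

quadratic-bound : ∀ {m k r} → m ≢ 1 → pronic r ℕ.≤ m ℕ.* pronic k →
  SqrtQuotientLe (discriminant m (k ℕ.+ r)) (coefficient m (k ℕ.+ r)) (+ m - + 1) (+ k)
quadratic-bound {zero} {k} {zero} _ _ =
  subst (λ n → SqrtQuotientLe (discriminant 0 n) (coefficient 0 n) (+ 0 - + 1) (+ k)) (sym (+-identityʳ k)) (edgeless-bound k)
quadratic-bound {zero} {r = suc _} _ ()
quadratic-bound {suc zero} m≢1 _ = contradiction refl m≢1
quadratic-bound {suc (suc a)} {k} {r} _ q≥0 =
  sqrtQuotientLe⁺ a k (discriminant-cast (suc a) (k ℕ.+ r)) (coefficient-cast (suc a) (k ℕ.+ r)) (discriminant≤square (suc a) k r q≥0)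

corollary3 : ∀ (n : ℕ) (G : Graph n) (k : ℕ) →
    IsIndependenceNumber G k →
    edgeCount G ≢ 1 →
    SqrtQuotientLe
      (+ 4 * (+ edgeCount G - + 1) * (+ n * + n + + n) + (+ edgeCount G + + 2 * + n + + 1) * (+ edgeCount G + + 2 * + n + + 1))
      (+ edgeCount G + + 2 * + n + + 1)
      (+ edgeCount G - + 1)
      (+ k)
corollary3 n G k α≡k m≢1 with r , refl ← m≤n⇒∃[o]m+o≡n (independenceNumber≤order G α≡k) =
  quadratic-bound m≢1 (independenceNumber-pronic-bound G α≡k)
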